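{- Let the edges of a complete bipartite graph $H$ be coloured red, green and blue such that each colour has at least four non-trivial monochromatic components. Then there are three monochromatic components that together span $H$.
   Context: A bipartite graph is trivial if one of its biparts has no vertices. A monochromatic component of colour $c$ is a connected component of the spanning subgraph formed by the edges of colour $c$. Components together span $H$ if the union of their vertex sets is $V(H)$. -}

module Defs where

open import Data.Nat using (ℕ)
open import Data.Fin using (Fin)
open import Data.Sum using (_⊎_; inj₁; inj₂)
open import Data.Product using (Σ; ∃; _×_; _,_)
open import Relation.Binary.PropositionalEquality using (_≡_; _≢_)
open import Relation.Nullary using (¬_)

-- The complete bipartite graph K_{m,n}: vertex set Fin m ⊎ Fin n
-- (left bipart Fin m, right bipart Fin n); every left vertex is adjacent
-- to every right vertex.
Vertex : ℕ → ℕ → Set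
Vertex m n = Fin m ⊎ Fin n

Colouring : ℕ → ℕ → Set
Colouring m n = Fin m → Fin n → Fin 3

data Adj {m n : ℕ} (χ : Colouring m n) (c : Fin 3) : Vertex m n → Vertex m n → Set where
  lr : ∀ a b → χ a b ≡ c → Adj χ c (inj₁ a) (inj₂ b)
  rl : ∀ a b → χ a b ≡ c → Adj χ c (inj₂ b) (inj₁ a)

data Conn {m n : ℕ} (χ : Colouring m n) (c : Fin 3) : Vertex m n → Vertex m n → Set where
  here : ∀ {u} → Conn χ c u u
  step : ∀ {u v w} → Adj χ c u v → Conn χ c v w → Conn χ c u w

-- The monochromatic component of colour c containing v has vertex set
-- { u | Conn χ c v u }.  It lies in v's component exactly when u does.
InComponent : {m n : ℕ} → Colouring m n → Fin 3 → Vertex m n → Vertex m n → Set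
InComponent χ c v u = Conn χ c v u

-- A component (viewed as a bipartite graph with biparts its intersections with
-- Fin m and Fin n) is non-trivial iff both biparts are non-empty.
NonTrivialComponent : {m n : ℕ} → Colouring m n → Fin 3 → Vertex m n → Set
NonTrivialComponent {m} {n} χ c v =
  (∃ λ (a : Fin m) → InComponent χ c v (inj₁ a)) ×
  (∃ λ (b : Fin n) → InComponent χ c v (inj₂ b))

AtLeastFourNonTrivial : {m n : ℕ} → Colouring m n → Fin 3 → Set
AtLeastFourNonTrivial {m} {n} χ c =
  Σ (Fin 4 → Vertex m n) λ r →
    (∀ i → NonTrivialComponent χ c (r i)) ×
    (∀ i j → i ≢ j → ¬ InComponent χ c (r i) (r j))

-- Fix a left vertex l. If every left vertex lies in some monochromatic
-- component of l, the three components of l span H, since every right vertex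
-- is adjacent to l. Otherwise some left vertex l′ lies in no component of l.
-- Among the four given c-components at most one contains l and one contains
-- l′, so two non-trivial c-components avoid both. A right vertex outside the
-- c-components of l and l′ is joined to l and l′ in the two other colours.
-- From this, l is joined to the right vertices of the two chosen c-components
-- in a single colour σ c ≠ c, and σ is not a 3-cycle. Hence σ swaps two
-- colours i and j, and the i- and j-components of l together with the
-- k-component of l′ span H.
module Submission where

open import Defs
open import Data.Nat using (ℕ)
open import Data.Fin using (Fin; zero; suc; inject₁; punchIn)
open import Data.Fin.Properties
  using (_≟_; all?; any?; ¬∀⟶∃¬; inject₁-injective; punchIn-injective; punchInᵢ≢i)
open import Data.Empty using (⊥; ⊥-elim)
open import Data.List using (List; []; _∷_; _++_; map; allFin; cartesianProduct)
open import Data.List.Membership.Propositional using (_∈_)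
open import Data.List.Membership.Propositional.Properties
  using (∈-cartesianProduct⁺; ∈-allFin; ∈-map⁺; ∈-++⁺ˡ; ∈-++⁺ʳ)
open import Data.List.Relation.Unary.Any using (here; there)
open import Data.Product using (∃; ∃₂; ∃-syntax; _×_; _,_; proj₁; proj₂)
import Data.Product as Product
open import Data.Sum using (_⊎_; inj₁; inj₂)
open import Data.Sum.Properties using (≡-dec)
open import Function using (id; _∘_; _∋_)
open import Function.Definitions using (Injective)
open import Relation.Binary.Core using (Rel)
open import Relation.Binary.Definitions using (Decidable; DecidableEquality)
open import Relation.Binary.PropositionalEquality
  using (_≡_; _≢_; refl; sym; trans; cong; isEquivalence)
open import Relation.Binary.Construct.Closure.ReflexiveTransitive using (ε; _◅_; _◅◅_)
open import Relation.Binary.Construct.Closure.Equivalence as EqClosure using (EqClosure)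
open import Relation.Binary.Construct.Closure.Symmetric using (fwd; bwd)
open import Relation.Nullary using (Dec; yes; no; ¬_)
open import Relation.Nullary.Decidable
  using (map′; from-yes; ¬?; _×-dec_; _⊎-dec_; _→-dec_; decidable-stable)
import Relation.Unary as U

private
  variable
    m n : ℕ
    χ : Colouring m n
    c d e i j k x y : Fin 3
    u v w : Vertex m n
    a : Fin m
    b : Fin n

-- Connectivity must be decided for the case analysis below; union-find does it.
module UnionFind {ℓ ℓ′} {V : Set ℓ} (_≟ᵥ_ : DecidableEquality V)
                 {E : Rel V ℓ′} (E? : Decidable E) where

  EdgeIn : List (V × V) → Rel V _
  EdgeIn ps s t = E s t × (s , t) ∈ ps

  redirect : V → V → V → V
  redirect s r z with z ≟ᵥ s
  ... | yes _ = r
  ... | no _  = z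

  redirect-hit : ∀ {s r z} → z ≡ s → redirect s r z ≡ r
  redirect-hit {s} {r} {z} z≡s with z ≟ᵥ s
  ... | yes _  = refl
  ... | no z≢s = ⊥-elim (z≢s z≡s)

  redirect-miss : ∀ {s r z} → z ≢ s → redirect s r z ≡ z
  redirect-miss {s} {r} {z} z≢s with z ≟ᵥ s
  ... | yes z≡s = ⊥-elim (z≢s z≡s)
  ... | no _    = refl

  redirect-target : ∀ s r → redirect s r r ≡ r
  redirect-target s r with r ≟ᵥ s
  ... | yes _ = refl
  ... | no _  = refl

  find : List (V × V) → V → V
  find [] = id
  find ((s , t) ∷ ps) with E? s t
  ... | yes _ = redirect (find ps t) (find ps s) ∘ find ps
  ... | no _  = find ps

  widen : ∀ {p ps s t} → EqClosure (EdgeIn ps) s t → EqClosure (EdgeIn (p ∷ ps)) s t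
  widen = EqClosure.map (Product.map₂ there)

  find-sound : ∀ ps s t → find ps s ≡ find ps t → EqClosure (EdgeIn ps) s t
  find-sound [] s .s refl = ε
  find-sound ((x , y) ∷ ps) s t eq with E? x y
  ... | no _  = widen (find-sound ps s t eq)
  ... | yes e = merged (find ps s ≟ᵥ find ps y) (find ps t ≟ᵥ find ps y)
    where
    f = find ps
    Joined = EqClosure (EdgeIn ((x , y) ∷ ps))

    joined : ∀ {s′ t′} → f s′ ≡ f t′ → Joined s′ t′
    joined = widen ∘ find-sound ps _ _

    x~y : Joined x y
    x~y = EqClosure.return (e , here refl)

    merged : Dec (f s ≡ f y) → Dec (f t ≡ f y) → Joined s t
    merged (yes s~y) (yes t~y) = joined (trans s~y (sym t~y))
    merged (yes s~y) (no t≁y)  =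
      joined s~y ◅◅ EqClosure.symmetric _ x~y ◅◅
      joined (trans (sym (redirect-hit s~y)) (trans eq (redirect-miss t≁y)))
    merged (no s≁y)  (yes t~y) =
      joined (trans (sym (redirect-miss s≁y)) (trans eq (redirect-hit t~y))) ◅◅
      x~y ◅◅ joined (sym t~y)
    merged (no s≁y)  (no t≁y)  =
      joined (trans (sym (redirect-miss s≁y)) (trans eq (redirect-miss t≁y)))

  find-respects : ∀ ps {s t} → EdgeIn ps s t → find ps s ≡ find ps t
  find-respects ((x , y) ∷ ps) (e , s∈) with E? x y | s∈
  ... | yes _ | here refl = trans (redirect-target (find ps y) (find ps x)) (sym (redirect-hit refl))
  ... | yes _ | there s∈′ = cong (redirect (find ps y) (find ps x)) (find-respects ps (e , s∈′))
  ... | no ¬e | here refl = ⊥-elim (¬e e)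
  ... | no _  | there s∈′ = find-respects ps (e , s∈′)

  eqClosure? : (vs : List V) → (∀ v → v ∈ vs) → Decidable (EqClosure E)
  eqClosure? vs ∈vs s t =
    map′ (EqClosure.map proj₁ ∘ find-sound ps s t)
         (EqClosure.gfold isEquivalence (find ps) (find-respects ps) ∘ EqClosure.map listed)
         (find ps s ≟ᵥ find ps t)
    where
    ps = cartesianProduct vs vs
    listed : ∀ {s t} → E s t → EdgeIn ps s t
    listed {s} {t} e = e , ∈-cartesianProduct⁺ (∈vs s) (∈vs t)

Distinct : Fin 3 → Fin 3 → Fin 3 → Set
Distinct c d e = c ≢ d × c ≢ e × d ≢ e

distinct? : ∀ c d e → Dec (Distinct c d e)
distinct? c d e = ¬? (c ≟ d) ×-dec ¬? (c ≟ e) ×-dec ¬? (d ≟ e)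

distinct-rotate : Distinct c d e → Distinct d e c
distinct-rotate (c≢d , c≢e , d≢e) = d≢e , c≢d ∘ sym , c≢e ∘ sym

distinct-swap : Distinct c d e → Distinct c e d
distinct-swap (c≢d , c≢e , d≢e) = c≢e , c≢d , d≢e ∘ sym

opaque
  exhaust : Distinct c d e → ∀ x → x ≡ c ⊎ x ≡ d ⊎ x ≡ e
  exhaust {c} {d} {e} = from-yes
    (Dec (∀ c d e → Distinct c d e → ∀ x → x ≡ c ⊎ x ≡ d ⊎ x ≡ e) ∋
     all? λ c → all? λ d → all? λ e →
       distinct? c d e →-dec all? λ x → x ≟ c ⊎-dec x ≟ d ⊎-dec x ≟ e) c d e

  third : c ≢ d → ∃ λ e → Distinct c d e
  third {c} {d} = from-yes
    (Dec (∀ c d → c ≢ d → ∃ λ e → Distinct c d e) ∋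
     all? λ c → all? λ d → ¬? (c ≟ d) →-dec any? λ e → distinct? c d e) c d

  third-unique : c ≢ e → x ≢ c → x ≢ e → y ≢ c → y ≢ e → x ≡ y
  third-unique {c} {e} {x} {y} = from-yes
    (Dec (∀ (c e x y : Fin 3) → c ≢ e → x ≢ c → x ≢ e → y ≢ c → y ≢ e → x ≡ y) ∋
     all? λ c → all? λ e → all? λ x → all? λ y →
       ¬? (c ≟ e) →-dec (¬? (x ≟ c) →-dec (¬? (x ≟ e) →-dec (¬? (y ≟ c) →-dec (¬? (y ≟ e) →-dec x ≟ y)))))
    c e x y

two-cycle : (σ : Fin 3 → Fin 3) → (∀ c → σ c ≢ c) →
            (∀ {i j k} → Distinct i j k → σ i ≡ j → σ j ≡ k → σ k ≡ i → ⊥) →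
            ∃₂ λ i j → ∃ λ k → Distinct i j k × σ i ≡ j × σ j ≡ i
two-cycle σ fixed-point-free no-three-cycle with third (fixed-point-free zero ∘ sym)
... | k , dist with exhaust dist (σ (σ zero))
...   | inj₁ back                 = zero , σ zero , k , dist , refl , back
...   | inj₂ (inj₁ fixed)         = ⊥-elim (fixed-point-free _ fixed)
...   | inj₂ (inj₂ σj≡k) with exhaust dist (σ k)
...     | inj₁ σk≡0         = ⊥-elim (no-three-cycle dist refl σj≡k σk≡0)
...     | inj₂ (inj₁ σk≡j)  = σ zero , k , zero , distinct-rotate dist , σj≡k , σk≡j
...     | inj₂ (inj₂ fixed) = ⊥-elim (fixed-point-free k fixed)

AtMostTwo : {A : Set} → (A → Set) → Set
AtMostTwo B = ∀ {i j k} → i ≢ j → i ≢ k → j ≢ k → B i → B j → B k → ⊥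

one-of-three-fails : {A : Set} {B : A → Set} → U.Decidable B → AtMostTwo B →
                     (f : Fin 3 → A) → Injective _≡_ _≡_ f → ∃ λ t → ¬ B (f t)
one-of-three-fails B? at-most-two f f-injective
  with B? (f zero) | B? (f (suc zero)) | B? (f (suc (suc zero)))
... | no ¬B₀ | _      | _      = zero , ¬B₀
... | yes _  | no ¬B₁ | _      = suc zero , ¬B₁
... | yes _  | yes _  | no ¬B₂ = suc (suc zero) , ¬B₂
... | yes B₀ | yes B₁ | yes B₂ =
  ⊥-elim (at-most-two ((λ ()) ∘ f-injective) ((λ ()) ∘ f-injective) ((λ ()) ∘ f-injective) B₀ B₁ B₂)

two-of-four-fail : {B : Fin 4 → Set} → U.Decidable B → AtMostTwo B →
                   ∃₂ λ s t → s ≢ t × ¬ B s × ¬ B t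
two-of-four-fail B? at-most-two
  with one-of-three-fails B? at-most-two inject₁ inject₁-injective
... | s , ¬Bs with one-of-three-fails B? at-most-two (punchIn (inject₁ s)) (punchIn-injective _ _ _)
...   | t , ¬Bt = inject₁ s , punchIn (inject₁ s) t , punchInᵢ≢i _ _ ∘ sym , ¬Bs , ¬Bt

adj-sym : Adj χ c u v → Adj χ c v u
adj-sym (lr a b p) = rl a b p
adj-sym (rl a b p) = lr a b p

conn-trans : Conn χ c u v → Conn χ c v w → Conn χ c u w
conn-trans here       q = q
conn-trans (step s p) q = step s (conn-trans p q)

conn-sym : Conn χ c u v → Conn χ c v u
conn-sym here       = here
conn-sym (step s p) = conn-trans (conn-sym p) (step (adj-sym s) here)

edge : χ a b ≡ c → Conn χ c (inj₁ a) (inj₂ b)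
edge {a = a} {b} p = step (lr a b p) here

step-right : Conn χ c u (inj₁ a) → χ a b ≡ c → Conn χ c u (inj₂ b)
step-right p ab≡c = conn-trans p (edge ab≡c)

step-left : Conn χ c u (inj₂ b) → χ a b ≡ c → Conn χ c u (inj₁ a)
step-left p ab≡c = conn-trans p (conn-sym (edge ab≡c))

adj? : (χ : Colouring m n) (c : Fin 3) → Decidable (Adj χ c)
adj? χ c (inj₁ a) (inj₂ b) = map′ (lr a b) (λ { (lr _ _ p) → p }) (χ a b ≟ c)
adj? χ c (inj₂ b) (inj₁ a) = map′ (rl a b) (λ { (rl _ _ p) → p }) (χ a b ≟ c)
adj? χ c (inj₁ _) (inj₁ _) = no λ ()
adj? χ c (inj₂ _) (inj₂ _) = no λ ()

vertices : ∀ m n → List (Vertex m n)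
vertices m n = map inj₁ (allFin m) ++ map inj₂ (allFin n)

∈-vertices : ∀ v → v ∈ vertices m n
∈-vertices (inj₁ a) = ∈-++⁺ˡ (∈-map⁺ inj₁ (∈-allFin a))
∈-vertices (inj₂ b) = ∈-++⁺ʳ _ (∈-map⁺ inj₂ (∈-allFin b))

conn⇒eqClosure : Conn χ c u v → EqClosure (Adj χ c) u v
conn⇒eqClosure here       = ε
conn⇒eqClosure (step s p) = fwd s ◅ conn⇒eqClosure p

eqClosure⇒conn : EqClosure (Adj χ c) u v → Conn χ c u v
eqClosure⇒conn ε         = here
eqClosure⇒conn (fwd s ◅ p) = step s (eqClosure⇒conn p)
eqClosure⇒conn (bwd s ◅ p) = step (adj-sym s) (eqClosure⇒conn p)

conn? : (χ : Colouring m n) (c : Fin 3) → Decidable (Conn χ c)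
conn? {m} {n} χ c u v = map′ eqClosure⇒conn conn⇒eqClosure
  (UnionFind.eqClosure? (≡-dec _≟_ _≟_) (adj? χ c) (vertices m n) ∈-vertices u v)

ThreeComponentCover : Colouring m n → Set
ThreeComponentCover {m} {n} χ =
  ∃[ c₁ ] ∃[ c₂ ] ∃[ c₃ ] ∃[ v₁ ] ∃[ v₂ ] ∃[ v₃ ]
    (∀ (u : Vertex m n) →
      InComponent χ c₁ v₁ u ⊎ InComponent χ c₂ v₂ u ⊎ InComponent χ c₃ v₃ u)

components-of-linking-vertex-cover : (l : Fin m) →
  (∀ a → ∃ λ c → Conn χ c (inj₁ l) (inj₁ a)) → ThreeComponentCover χ
components-of-linking-vertex-cover {χ = χ} l linked =
  zero , suc zero , suc (suc zero) , inj₁ l , inj₁ l , inj₁ l , cover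
  where
  in-some-colour : ∀ c → Conn χ c (inj₁ l) u →
    Conn χ zero (inj₁ l) u ⊎ Conn χ (suc zero) (inj₁ l) u ⊎ Conn χ (suc (suc zero)) (inj₁ l) u
  in-some-colour zero             p = inj₁ p
  in-some-colour (suc zero)       p = inj₂ (inj₁ p)
  in-some-colour (suc (suc zero)) p = inj₂ (inj₂ p)

  cover : ∀ u → _
  cover (inj₁ a) = in-some-colour _ (proj₂ (linked a))
  cover (inj₂ b) = in-some-colour (χ l b) (edge refl)

separated-or-linking : (χ : Colouring m n) (l : Fin m) →
  (∃ λ l′ → ∀ c → ¬ Conn χ c (inj₁ l) (inj₁ l′)) ⊎ (∀ a → ∃ λ c → Conn χ c (inj₁ l) (inj₁ a))
separated-or-linking χ l with any? (λ l′ → all? λ c → ¬? (conn? χ c (inj₁ l) (inj₁ l′)))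
... | yes separated   = inj₁ separated
... | no ¬separated = inj₂ λ a →
  Product.map₂ (λ {c} → decidable-stable (conn? χ c _ _))
    (¬∀⟶∃¬ 3 _ (λ c → ¬? (conn? χ c _ _)) (¬separated ∘ (a ,_)))

module Separated {m n : ℕ} (χ : Colouring m n) (l l′ : Fin m)
                 (separated : ∀ c → ¬ Conn χ c (inj₁ l) (inj₁ l′)) where

  X Y Covered Outside : Fin 3 → Vertex m n → Set
  X c = Conn χ c (inj₁ l)
  Y c = Conn χ c (inj₁ l′)
  Covered c v = X c v ⊎ Y c v
  Outside c v = ¬ Covered c v

  not-both : X c v → Y c v → ⊥
  not-both x y = separated _ (conn-trans x (conn-sym y))

  covered? : ∀ c v → Dec (Covered c v)
  covered? c v = conn? χ c _ v ⊎-dec conn? χ c _ v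

  covered-closed : Covered c u → Conn χ c u v → Covered c v
  covered-closed (inj₁ x) p = inj₁ (conn-trans x p)
  covered-closed (inj₂ y) p = inj₂ (conn-trans y p)

  outside-closed : Outside c u → Conn χ c u v → Outside c v
  outside-closed out p cov = out (covered-closed cov (conn-sym p))

  outside-right-Y : Outside c (inj₂ b) → e ≢ c → χ l b ≢ e → Y e (inj₂ b)
  outside-right-Y {c} {b} {e} out e≢c lb≢e = edge (third-unique c≢lb l′b≢c l′b≢lb e≢c (lb≢e ∘ sym))
    where
    c≢lb : c ≢ χ l b
    c≢lb p = out (inj₁ (edge (sym p)))
    l′b≢c : χ l′ b ≢ c
    l′b≢c p = out (inj₂ (edge p))
    l′b≢lb : χ l′ b ≢ χ l b
    l′b≢lb p = not-both (edge (sym p)) (edge refl)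

  outside-right-X : Outside c (inj₂ b) → e ≢ c → X e (inj₂ b) → χ l b ≡ e
  outside-right-X {c} {b} {e} out e≢c x with χ l b ≟ e
  ... | yes lb≡e = lb≡e
  ... | no lb≢e  = ⊥-elim (not-both x (outside-right-Y out e≢c lb≢e))

  outside-right-covered : Outside c (inj₂ b) → e ≢ c → Covered e (inj₂ b)
  outside-right-covered {c} {b} {e} out e≢c with χ l b ≟ e
  ... | yes lb≡e = inj₁ (edge lb≡e)
  ... | no lb≢e  = inj₂ (outside-right-Y out e≢c lb≢e)

  outside-not-joined : Outside c (inj₁ a) → Outside d (inj₂ b) → c ≢ d → χ a b ≢ c
  outside-not-joined outa outb c≢d ab≡c =
    outa (covered-closed (outside-right-covered outb c≢d) (step-left here ab≡c))

  same-left-colour : ∀ {b b′} → Outside c (inj₂ b) → Outside c (inj₂ b′) → e ≢ c →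
                     Conn χ e (inj₂ b) (inj₂ b′) → χ l b ≡ χ l b′
  same-left-colour {c} {e} {b} {b′} out out′ e≢c bb′ with χ l b ≟ e
  ... | yes lb≡e = trans lb≡e (sym (outside-right-X out′ e≢c (conn-trans (edge lb≡e) bb′)))
  ... | no lb≢e  = third-unique (e≢c ∘ sym) (λ p → out (inj₁ (edge p))) lb≢e
                                 (λ p → out′ (inj₁ (edge p))) lb′≢e
    where
    lb′≢e : χ l b′ ≢ e
    lb′≢e p = not-both (edge p) (conn-trans (outside-right-Y out e≢c lb≢e) bb′)

  at-most-two-covered : {r : Fin 4 → Vertex m n} →
    (∀ s t → s ≢ t → ¬ Conn χ c (r s) (r t)) → AtMostTwo (Covered c ∘ r)
  at-most-two-covered apart s≢t _    _    (inj₁ x) (inj₁ x′) _        = apart _ _ s≢t (conn-trans (conn-sym x) x′)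
  at-most-two-covered apart s≢t _    _    (inj₂ y) (inj₂ y′) _        = apart _ _ s≢t (conn-trans (conn-sym y) y′)
  at-most-two-covered apart _   s≢u  _    (inj₁ x) (inj₂ _)  (inj₁ x′) = apart _ _ s≢u (conn-trans (conn-sym x) x′)
  at-most-two-covered apart _   _    t≢u  (inj₁ _) (inj₂ y)  (inj₂ y′) = apart _ _ t≢u (conn-trans (conn-sym y) y′)
  at-most-two-covered apart _   _    t≢u  (inj₂ _) (inj₁ x)  (inj₁ x′) = apart _ _ t≢u (conn-trans (conn-sym x) x′)
  at-most-two-covered apart _   s≢u  _    (inj₂ y) (inj₁ _)  (inj₂ y′) = apart _ _ s≢u (conn-trans (conn-sym y) y′)

  record OutsidePair (c : Fin 3) : Set where
    field
      α₁ α₂ : Fin m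
      β₁ β₂ : Fin n
      α₁β₁ : Conn χ c (inj₁ α₁) (inj₂ β₁)
      α₂β₂ : Conn χ c (inj₁ α₂) (inj₂ β₂)
      α₁-outside : Outside c (inj₁ α₁)
      α₂-outside : Outside c (inj₁ α₂)
      apart : ¬ Conn χ c (inj₁ α₁) (inj₁ α₂)

  outside-pair : AtLeastFourNonTrivial χ c → OutsidePair c
  outside-pair {c} (r , nontrivial , disjoint) =
    from-outside (two-of-four-fail (covered? c ∘ r) (at-most-two-covered disjoint))
    where
    from-outside : (∃₂ λ s t → s ≢ t × Outside c (r s) × Outside c (r t)) → OutsidePair c
    from-outside (s , t , s≢t , out-s , out-t) with nontrivial s | nontrivial t
    ... | (α₁ , rα₁) , (β₁ , rβ₁) | (α₂ , rα₂) , (β₂ , rβ₂) = record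
      { α₁ = α₁ ; α₂ = α₂ ; β₁ = β₁ ; β₂ = β₂
      ; α₁β₁ = conn-trans (conn-sym rα₁) rβ₁
      ; α₂β₂ = conn-trans (conn-sym rα₂) rβ₂
      ; α₁-outside = outside-closed out-s rα₁
      ; α₂-outside = outside-closed out-t rα₂
      ; apart = λ p → disjoint s t s≢t (conn-trans rα₁ (conn-trans p (conn-sym rα₂)))
      }

  module WithPairs (P : ∀ c → OutsidePair c) where
    open module Pairs (c : Fin 3) = OutsidePair (P c)

    RightEnd : Fin 3 → Fin n → Set
    RightEnd c b = b ≡ β₁ c ⊎ b ≡ β₂ c

    rightEnd-outside : RightEnd c b → Outside c (inj₂ b)
    rightEnd-outside {c} (inj₁ refl) = outside-closed (α₁-outside c) (α₁β₁ c)
    rightEnd-outside {c} (inj₂ refl) = outside-closed (α₂-outside c) (α₂β₂ c)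

    off-colour-rightEnd : ∀ c a → ∃ λ b → RightEnd c b × χ a b ≢ c
    off-colour-rightEnd c a with χ a (β₁ c) ≟ c | χ a (β₂ c) ≟ c
    ... | no ab₁≢c | _        = β₁ c , inj₁ refl , ab₁≢c
    ... | yes _    | no ab₂≢c = β₂ c , inj₂ refl , ab₂≢c
    ... | yes ab₁  | yes ab₂  = ⊥-elim (apart c
      (conn-trans (step-right (step-left (α₁β₁ c) ab₁) ab₂) (conn-sym (α₂β₂ c))))

    off-colour-outside-left : ∀ c b → ∃ λ a → Outside c (inj₁ a) × χ a b ≢ c
    off-colour-outside-left c b with χ (α₁ c) b ≟ c | χ (α₂ c) b ≟ c
    ... | no a₁b≢c | _        = α₁ c , α₁-outside c , a₁b≢c
    ... | yes _    | no a₂b≢c = α₂ c , α₂-outside c , a₂b≢c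
    ... | yes a₁b  | yes a₂b  = ⊥-elim (apart c (step-left (edge a₁b) a₂b))

    σ : Fin 3 → Fin 3
    σ c = χ l (β₁ c)

    σ-fixed-point-free : ∀ c → σ c ≢ c
    σ-fixed-point-free c p = rightEnd-outside (inj₁ refl) (inj₁ (edge p))

    third-colour-edge : Outside c (inj₁ a) → Distinct c d e → ∃ λ b → RightEnd d b × χ a b ≡ e
    third-colour-edge {c} {a} {d} out dist@(c≢d , _) with off-colour-rightEnd d a
    ... | b , end , ab≢d with exhaust dist (χ a b)
    ...   | inj₁ ab≡c        = ⊥-elim (outside-not-joined out (rightEnd-outside end) c≢d ab≡c)
    ...   | inj₂ (inj₁ ab≡d) = ⊥-elim (ab≢d ab≡d)
    ...   | inj₂ (inj₂ ab≡e) = b , end , ab≡e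

    outside-left-covered : Outside c (inj₁ a) → Distinct c d e → Covered e (inj₁ a)
    outside-left-covered out dist@(_ , _ , d≢e) with third-colour-edge out dist
    ... | b , end , ab≡e =
      covered-closed (outside-right-covered (rightEnd-outside end) (d≢e ∘ sym)) (step-left here ab≡e)

    α₁-edge-colour : Outside c (inj₂ b) → Distinct c d e → χ (α₁ d) b ≡ e
    α₁-edge-colour {c} {b} {d} out dist@(c≢d , _) with exhaust dist (χ (α₁ d) b)
    ... | inj₁ ab≡c        =
      ⊥-elim (out (covered-closed (outside-left-covered (α₁-outside d) (distinct-rotate dist)) (edge ab≡c)))
    ... | inj₂ (inj₁ ab≡d) = ⊥-elim (outside-not-joined (α₁-outside d) out (c≢d ∘ sym) ab≡d)
    ... | inj₂ (inj₂ ab≡e) = ab≡e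

    rightEnd-σ : RightEnd c b → χ l b ≡ σ c
    rightEnd-σ (inj₁ refl) = refl
    rightEnd-σ {c} (inj₂ refl) with third (σ-fixed-point-free c ∘ sym)
    ... | e , dist@(_ , c≢e , _) =
      same-left-colour (rightEnd-outside (inj₂ refl)) (rightEnd-outside (inj₁ refl)) (c≢e ∘ sym)
        (step-right (step-left here (α₁-edge-colour (rightEnd-outside (inj₂ refl)) dist))
                    (α₁-edge-colour (rightEnd-outside (inj₁ refl)) dist))

    rightEnd-in-X : RightEnd c b → σ c ≡ e → X e (inj₂ b)
    rightEnd-in-X end σc≡e = edge (trans (rightEnd-σ end) σc≡e)

    rightEnd-in-Y : RightEnd c b → e ≢ c → σ c ≢ e → Y e (inj₂ b)
    rightEnd-in-Y end e≢c σc≢e =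
      outside-right-Y (rightEnd-outside end) e≢c (σc≢e ∘ trans (sym (rightEnd-σ end)))

    outside-left-in-X : Outside c (inj₁ a) → Distinct c d e → σ d ≡ e → X e (inj₁ a)
    outside-left-in-X out dist σd≡e with third-colour-edge out dist
    ... | b , end , ab≡e = step-left (rightEnd-in-X end σd≡e) ab≡e

    outside-left-in-Y : Outside c (inj₁ a) → Distinct c d e → σ d ≢ e → Y e (inj₁ a)
    outside-left-in-Y out dist@(_ , _ , d≢e) σd≢e with third-colour-edge out dist
    ... | b , end , ab≡e = step-left (rightEnd-in-Y end (d≢e ∘ sym) σd≢e) ab≡e

    no-three-cycle : Distinct i j k → σ i ≡ j → σ j ≡ k → σ k ≡ i → ⊥
    no-three-cycle {i} {j} {k} dist@(i≢j , i≢k , j≢k) σi≡j σj≡k σk≡i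
      with off-colour-rightEnd i (α₁ i)
    ... | b , end , ab≢i with exhaust dist (χ (α₁ i) b)
    ...   | inj₁ ab≡i        = ab≢i ab≡i
    ...   | inj₂ (inj₁ ab≡j) =
      not-both (step-left (rightEnd-in-X end σi≡j) ab≡j)
               (outside-left-in-Y (α₁-outside i) (distinct-swap dist) (i≢j ∘ trans (sym σk≡i)))
    ...   | inj₂ (inj₂ ab≡k) =
      not-both (outside-left-in-X (α₁-outside i) dist σj≡k)
               (step-left (rightEnd-in-Y end (i≢k ∘ sym) (j≢k ∘ trans (sym σi≡j))) ab≡k)

    two-cycle-cover : Distinct i j k → σ i ≡ j → σ j ≡ i → ThreeComponentCover χ
    two-cycle-cover {i} {j} {k} dist@(_ , i≢k , j≢k) σi≡j σj≡i =
      i , j , k , inj₁ l , inj₁ l , inj₁ l′ , cover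
      where
      kij : Distinct k i j
      kij = distinct-rotate (distinct-rotate dist)

      cover : ∀ u → X i u ⊎ X j u ⊎ Y k u
      cover (inj₁ a) with off-colour-rightEnd i a
      ... | b , end , ab≢i with exhaust dist (χ a b)
      ...   | inj₁ ab≡i        = ⊥-elim (ab≢i ab≡i)
      ...   | inj₂ (inj₁ ab≡j) = inj₂ (inj₁ (step-left (rightEnd-in-X end σi≡j) ab≡j))
      ...   | inj₂ (inj₂ ab≡k) =
        inj₂ (inj₂ (step-left (rightEnd-in-Y end (i≢k ∘ sym) (j≢k ∘ trans (sym σi≡j))) ab≡k))
      cover (inj₂ b) with exhaust dist (χ l b)
      ... | inj₁ lb≡i        = inj₁ (edge lb≡i)
      ... | inj₂ (inj₁ lb≡j) = inj₂ (inj₁ (edge lb≡j))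
      ... | inj₂ (inj₂ _) with off-colour-outside-left k b
      ...   | a , out , ab≢k with exhaust dist (χ a b)
      ...     | inj₁ ab≡i        = inj₁ (step-right (outside-left-in-X out (distinct-swap kij) σj≡i) ab≡i)
      ...     | inj₂ (inj₁ ab≡j) = inj₂ (inj₁ (step-right (outside-left-in-X out kij σi≡j) ab≡j))
      ...     | inj₂ (inj₂ ab≡k) = ⊥-elim (ab≢k ab≡k)

    cover : ThreeComponentCover χ
    cover with two-cycle σ σ-fixed-point-free no-three-cycle
    ... | i , j , k , dist , σi≡j , σj≡i = two-cycle-cover dist σi≡j σj≡i

some-left-vertex : {χ : Colouring m n} → AtLeastFourNonTrivial χ c → Fin m
some-left-vertex (_ , nontrivial , _) = proj₁ (proj₁ (nontrivial zero))

lemma7 : (m n : ℕ) (χ : Colouring m n) →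
         (∀ (c : Fin 3) → AtLeastFourNonTrivial χ c) →
         ∃[ c₁ ] ∃[ c₂ ] ∃[ c₃ ] ∃[ v₁ ] ∃[ v₂ ] ∃[ v₃ ]
           (∀ (u : Vertex m n) →
             InComponent χ c₁ v₁ u ⊎ InComponent χ c₂ v₂ u ⊎ InComponent χ c₃ v₃ u)
lemma7 m n χ four with separated-or-linking χ (some-left-vertex (four zero))
... | inj₂ linking            = components-of-linking-vertex-cover _ linking
... | inj₁ (l′ , separated) = WithPairs.cover (λ c → outside-pair (four c))
  where open Separated χ (some-left-vertex (four zero)) l′ separated
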